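{- Let $G$ be a graph, $S\subseteq V(G)$, $C'$ a connected component of $G-S$, $C=G[V(C')\cup S]$ and $C^-=C-S$. Let $(T,\chi)$ be a lenient tree decomposition of $G$, $s\in V(T)$, and for each $x\in S$ let $Z_x$ be a path in $T$ from $s$ to a node of ${\sf Trace}(x)$. Define $\chi'(t)=(\chi(t)\cap V(C^-))\cup\{x\in S: t\in V(Z_x)\}$ for $t\in V(T)$. Suppose $G-(V(C)\setminus S)$ contains a family $\{P_x:x\in S\}$ of pairwise vertex-disjoint $S$–$\chi(s)$ paths such that $x$ is a terminal vertex of $P_x$. Then $|\chi'(t)|\le|\chi(t)|$ for every $t\in V(T)$.
   Context: Lenient tree decomposition: $(T,\chi)$, $T$ a tree, $\chi:V(T)\to 2^{V(G)}$, with (C1) bags covering $V(G)$; (C2) every edge $e$ of $G$ satisfies $e\subseteq\chi(t)\cup\chi(t')$ for some close nodes $t,t'$ (equal or adjacent); (C3) ${\sf Trace}(x)=\{t:x\in\chi(t)\}$ is connected in $T$ for every $x$. An $X$–$Y$ path is a path with one terminal in $X$ and the other in $Y$ (a single vertex is allowed). -}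

module Defs where

open import Data.Nat using (ℕ; _≤_)
open import Data.Fin using (Fin; _≟_)
open import Data.Fin.Subset using (Subset; _∈_; _∉_; _∩_; _∪_; ∣_∣)
open import Data.Fin.Subset.Properties using (_∈?_)
open import Data.Bool using (Bool; _∧_)
open import Data.List using (List; []; _∷_; length)
open import Data.Bool.ListAction using (any)
open import Data.List.Relation.Unary.All using (All)
open import Data.List.Relation.Unary.Unique.Propositional using (Unique)
import Data.List.Membership.Propositional as LMem
open import Data.Vec using (tabulate)
open import Data.Product using (Σ; ∃; _×_; _,_)
open import Data.Sum using (_⊎_)
open import Relation.Binary.PropositionalEquality using (_≡_)
open import Relation.Nullary using (¬_; ⌊_⌋)

record Graph (n : ℕ) : Set₁ where
  field
    Adj   : Fin n → Fin n → Set
    sym   : ∀ {u v} → Adj u v → Adj v u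
    irrefl : ∀ {u} → ¬ Adj u u

data Walk {A : Set} (E : A → A → Set) : A → A → List A → Set where
  single : ∀ u → Walk E u u (u ∷ [])
  step   : ∀ {u w v p} → E u w → Walk E w v p → Walk E u v (u ∷ p)

IsPath : {A : Set} (E : A → A → Set) → A → A → List A → Set
IsPath E u v p = Walk E u v p × Unique p

_⊆ˡ_ : ∀ {n} → List (Fin n) → Subset n → Set
p ⊆ˡ X = All (λ y → y ∈ X) p

record IsTree {m : ℕ} (T : Graph m) : Set where
  open Graph T
  field
    connected : ∀ u v → ∃ λ p → IsPath Adj u v p
    acyclic   : ∀ u v p → IsPath Adj u v p → 3 ≤ length p → ¬ Adj v u

-- Trace(x) = { t : x ∈ χ(t) }; "connected in T" means any two of its nodes
-- are joined by a path of T all of whose nodes lie in Trace(x).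
TraceConnected : ∀ {m n} (T : Graph m) (χ : Fin m → Subset n) (x : Fin n) → Set
TraceConnected T χ x =
  ∀ t t' → x ∈ χ t → x ∈ χ t' →
    ∃ λ p → IsPath (Graph.Adj T) t t' p × All (λ r → x ∈ χ r) p

record IsLenientTD {n m : ℕ} (G : Graph n) (T : Graph m) (χ : Fin m → Subset n) : Set where
  field
    tree : IsTree T
    C1   : ∀ x → ∃ λ t → x ∈ χ t
    C2   : ∀ u v → Graph.Adj G u v →
             ∃ λ t → ∃ λ t' → (t ≡ t' ⊎ Graph.Adj T t t')
               × (u ∈ (χ t ∪ χ t')) × (v ∈ (χ t ∪ χ t'))
    C3   : ∀ x → TraceConnected T χ x

record IsComponentOfMinus {n : ℕ} (G : Graph n) (S C' : Subset n) : Set where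
  field
    nonempty  : ∃ λ v → v ∈ C'
    avoidsS   : ∀ v → v ∈ C' → v ∉ S
    connected : ∀ u v → u ∈ C' → v ∈ C' →
                  ∃ λ p → IsPath (Graph.Adj G) u v p × p ⊆ˡ C'
    maximal   : ∀ u v → u ∈ C' → v ∉ S → Graph.Adj G u v → v ∈ C'

_∈ᵇ_ : ∀ {m} → Fin m → List (Fin m) → Bool
t ∈ᵇ p = any (λ r → ⌊ r ≟ t ⌋) p

-- χ'(t) = (χ(t) ∩ V(C⁻)) ∪ { x ∈ S : t ∈ V(Z_x) },  where V(C⁻) = V(C').
χ' : ∀ {n m} (χ : Fin m → Subset n) (S C' : Subset n)
     (Z : Fin n → List (Fin m)) → Fin m → Subset n
χ' χ S C' Z t = (χ t ∩ C') ∪ tabulate (λ x → ⌊ x ∈? S ⌋ ∧ (t ∈ᵇ Z x))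

IsXYPathAvoiding : ∀ {n} (G : Graph n) (X Y D : Subset n) (a b : Fin n) (P : List (Fin n)) → Set
IsXYPathAvoiding G X Y D a b P =
  IsPath (Graph.Adj G) a b P × All (λ y → y ∉ D) P
  × ((a ∈ X × b ∈ Y) ⊎ (a ∈ Y × b ∈ X))

-- The bags of χ' are charged injectively to the bags of χ. A vertex x of
-- χ'(t) ∩ C⁻ is charged to itself. For x ∈ S with t on Z_x, the path P_x
-- contains a walk of G from a vertex of χ(s) to x; lifting it through the
-- decomposition gives a walk of T from s to the end of Z_x all of whose bags
-- meet P_x, and since T is a tree this walk passes through every node of the
-- path Z_x, in particular through t. So x is charged to a vertex of P_x in
-- χ(t). The P_x are pairwise disjoint and avoid C, so no vertex is charged
-- twice.
module Submission where

open import Defs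
open import Data.Nat using (ℕ; _≤_; s≤s; z≤n; _≤?_)
open import Data.Nat.Properties using (≤-trans)
open import Data.Fin using (Fin; suc; _≟_)
open import Data.Fin.Properties using (suc-injective; 0≢1+n)
open import Data.Fin.Subset using (Subset; _∈_; _∉_; ∣_∣; _∩_; _-_; inside; outside)
open import Data.Fin.Subset.Properties using (_∈?_; x∈p∩q⁻; x∈p∪q⁻; x∈p∧x≢y⇒x∈p-y; x∈p⇒∣p-x∣<∣p∣)
open import Data.Vec using (_∷_; []; tabulate; here; there)
open import Data.Vec.Properties using (lookup∘tabulate; []=⇒lookup)
open import Data.Bool using (Bool; T)
open import Data.Bool.Properties using (T-≡; T-∧)
open import Data.Bool.ListAction using (any)
open import Data.List using (List; []; _∷_; _++_; length)
open import Data.List.Membership.Propositional using () renaming (_∈_ to _∈ₗ_)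
open import Data.List.Membership.Propositional.Properties using (∈-++⁺ʳ; ∈-++⁻)
import Data.List.Membership.DecPropositional as DecMembership
open import Data.List.Relation.Binary.Subset.Propositional using (_⊆_)
open import Data.List.Relation.Unary.Any as Any using (here; there)
open import Data.List.Relation.Unary.Any.Properties using (any⁻)
open import Data.List.Relation.Unary.All as All using (All; []; _∷_)
open import Data.List.Relation.Unary.All.Properties using (++⁺; anti-mono; ¬Any⇒All¬)
open import Data.List.Relation.Unary.AllPairs using ([]; _∷_)
open import Data.Product using (∃; ∃₂; _×_; _,_; proj₁)
open import Data.Sum using (_⊎_; inj₁; inj₂; [_,_]′)
open import Data.Empty using (⊥-elim)
open import Function using (_∘_; id)
open import Function.Bundles using (Equivalence)
open import Relation.Binary.PropositionalEquality using (_≡_; refl; sym; trans)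
open import Relation.Nullary using (¬_; yes; no; toWitness)

module _ {A : Set} {E : A → A → Set} where

  head∈ : ∀ {u v p} → Walk E u v p → u ∈ₗ p
  head∈ (single _) = here refl
  head∈ (step _ _) = here refl

  last∈ : ∀ {u v p} → Walk E u v p → v ∈ₗ p
  last∈ (single _) = here refl
  last∈ (step _ w) = there (last∈ w)

  append : ∀ {u v x p r} → Walk E u v p → Walk E v x r →
           ∃ λ s → Walk E u x s × s ⊆ p ++ r
  append (single _) w = _ , w , ∈-++⁺ʳ (_ ∷ [])
  append (step e w₁) w₂ with append w₁ w₂
  ... | s , w , s⊆ = _ , step e w , λ { (here refl) → here refl ; (there i) → there (s⊆ i) }

  append-All : ∀ {P : A → Set} {u v x p r} → Walk E u v p → Walk E v x r →
               All P p → All P r → ∃ λ s → Walk E u x s × All P s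
  append-All w₁ w₂ Pp Pr with append w₁ w₂
  ... | s , w , s⊆ = s , w , anti-mono s⊆ (++⁺ Pp Pr)

  closedPath-trivial : ∀ {u p} → IsPath E u u p → p ≡ u ∷ []
  closedPath-trivial (single _ , _) = refl
  closedPath-trivial (step _ w , u∉p ∷ _) = ⊥-elim (All.lookup u∉p (last∈ w) refl)

  shortWalk-ends : ∀ {u x q z} → Walk E u x q → ¬ 3 ≤ length q → z ∈ₗ q → z ≡ u ⊎ z ≡ x
  shortWalk-ends (single _) _ (here refl) = inj₁ refl
  shortWalk-ends (step _ (single _)) _ (here refl) = inj₁ refl
  shortWalk-ends (step _ (single _)) _ (there (here refl)) = inj₂ refl
  shortWalk-ends (step _ (step _ (single _))) ¬3≤ _ = ⊥-elim (¬3≤ (s≤s (s≤s (s≤s z≤n))))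
  shortWalk-ends (step _ (step _ (step _ _))) ¬3≤ _ = ⊥-elim (¬3≤ (s≤s (s≤s (s≤s z≤n))))

  splitPath : ∀ {u v p x} → IsPath E u v p → x ∈ₗ p →
              ∃₂ λ q r → IsPath E u x q × IsPath E x v r × p ⊆ q ++ r × q ⊆ p
  splitPath (single _ , un) (here refl) = _ , _ , (single _ , [] ∷ []) , (single _ , un) ,
    ∈-++⁺ʳ (_ ∷ []) , id
  splitPath (step e w , un) (here refl) = _ , _ , (single _ , [] ∷ []) , (step e w , un) ,
    ∈-++⁺ʳ (_ ∷ []) , λ { (here refl) → here refl }
  splitPath (single _ , _) (there ())
  splitPath (step e w , u∉p ∷ un) (there i) with splitPath (w , un) i
  ... | q , r , (wq , uq) , pr , p⊆ , q⊆ =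
    _ , r , (step e wq , anti-mono q⊆ u∉p ∷ uq) , pr ,
    (λ { (here refl) → here refl ; (there j) → there (p⊆ j) }) ,
    (λ { (here refl) → here refl ; (there j) → there (q⊆ j) })

  module _ (E-sym : ∀ {a b} → E a b → E b a) where

    reverse : ∀ {u v p} → Walk E u v p → ∃ λ s → Walk E v u s × s ⊆ p
    reverse (single u) = _ , single u , id
    reverse (step {u} {u′} e w) with reverse w
    ... | s , w′ , s⊆ with append w′ (step (E-sym e) (single _))
    ... | s′ , w″ , s′⊆ = s′ , w″ , λ z∈s′ → [ there ∘ s⊆ , lastStep ]′ (∈-++⁻ s (s′⊆ z∈s′))
      where
      lastStep : u′ ∷ u ∷ [] ⊆ u ∷ _
      lastStep (here refl) = there (head∈ w)
      lastStep (there (here refl)) = here refl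

    walkBetweenEnds : ∀ {a b p y x} → Walk E a b p → a ≡ y ⊎ b ≡ y → a ≡ x ⊎ b ≡ x →
                      ∃ λ q → Walk E y x q × q ⊆ p
    walkBetweenEnds w (inj₁ refl) (inj₁ refl) = _ , single _ , λ { (here refl) → head∈ w }
    walkBetweenEnds w (inj₁ refl) (inj₂ refl) = _ , w , id
    walkBetweenEnds w (inj₂ refl) (inj₁ refl) = reverse w
    walkBetweenEnds w (inj₂ refl) (inj₂ refl) = _ , single _ , λ { (here refl) → last∈ w }

module _ {m} {T : Graph m} (tree : IsTree T) where
  open Graph T using (Adj) renaming (sym to Adj-sym)
  open DecMembership (_≟_ {m}) using () renaming (_∈?_ to _∈ₗ?_)

  -- If the walk's first step u u′ lands on the path, the segment of the path
  -- from u to u′ would close a cycle with that edge unless it is just u u′.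
  path⊆walk : ∀ {u v p w} → IsPath Adj u v p → Walk Adj u v w → p ⊆ w
  path⊆walk path (single _) rewrite closedPath-trivial path = id
  path⊆walk {p = p} (wp , up) (step {w = u′} e w) with u′ ∈ₗ? p
  ... | no u′∉p = λ z∈p → there (path⊆walk (step (Adj-sym e) wp , ¬Any⇒All¬ p u′∉p ∷ up) w (there z∈p))
  ... | yes u′∈p with splitPath (wp , up) u′∈p
  ... | q , r , pq , pr , p⊆ , _ = λ z∈p → [ onCycle , there ∘ path⊆walk pr w ]′ (∈-++⁻ q (p⊆ z∈p))
    where
    onCycle : q ⊆ _
    onCycle z∈q with 3 ≤? length q
    ... | yes 3≤ = ⊥-elim (IsTree.acyclic tree _ _ q pq 3≤ (Adj-sym e))
    ... | no ¬3≤ with shortWalk-ends (proj₁ pq) ¬3≤ z∈q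
    ... | inj₁ refl = here refl
    ... | inj₂ refl = there (head∈ w)

module _ {n m} {G : Graph n} {T : Graph m} {χ : Fin m → Subset n} (td : IsLenientTD G T χ) where
  open IsLenientTD td

  Meets : List (Fin n) → Fin m → Set
  Meets q t = ∃ λ v → v ∈ₗ q × v ∈ χ t

  Meets-mono : ∀ {q q′ t} → q ⊆ q′ → Meets q t → Meets q′ t
  Meets-mono q⊆ (v , v∈q , v∈χt) = v , q⊆ v∈q , v∈χt

  Close : Fin m → Fin m → Set
  Close t t′ = t ≡ t′ ⊎ Graph.Adj T t t′

  Close-sym : ∀ {t t′} → Close t t′ → Close t′ t
  Close-sym (inj₁ refl) = inj₁ refl
  Close-sym (inj₂ a) = inj₂ (Graph.sym T a)

  Close⇒walk : ∀ {t t′} → Close t t′ → ∃ λ w → Walk (Graph.Adj T) t t′ w × w ⊆ t ∷ t′ ∷ []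
  Close⇒walk (inj₁ refl) = _ , single _ , λ { (here refl) → here refl }
  Close⇒walk (inj₂ a) = _ , step a (single _) , id

  edge∈closeBags : ∀ {u v} → Graph.Adj G u v →
                   ∃₂ λ t t′ → u ∈ χ t × v ∈ χ t′ × Close t t′
  edge∈closeBags {u} {v} e with C2 u v e
  ... | t , t′ , c , u∈ , v∈ with x∈p∪q⁻ (χ t) (χ t′) u∈ | x∈p∪q⁻ (χ t) (χ t′) v∈
  ... | inj₁ u∈χt  | inj₁ v∈χt  = t , t , u∈χt , v∈χt , inj₁ refl
  ... | inj₁ u∈χt  | inj₂ v∈χt′ = t , t′ , u∈χt , v∈χt′ , c
  ... | inj₂ u∈χt′ | inj₁ v∈χt  = t′ , t , u∈χt′ , v∈χt , Close-sym c
  ... | inj₂ u∈χt′ | inj₂ v∈χt′ = t′ , t′ , u∈χt′ , v∈χt′ , inj₁ refl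

  edge⇒bagWalk : ∀ {u v} → Graph.Adj G u v →
                 ∃₂ λ t t′ → u ∈ χ t × v ∈ χ t′ ×
                   ∃ λ w → Walk (Graph.Adj T) t t′ w × All (λ r → u ∈ χ r ⊎ v ∈ χ r) w
  edge⇒bagWalk e with edge∈closeBags e
  ... | t , t′ , u∈ , v∈ , c with Close⇒walk c
  ... | w , ww , w⊆ = t , t′ , u∈ , v∈ , w , ww , anti-mono w⊆ (inj₁ u∈ ∷ inj₂ v∈ ∷ [])

  walk⇒bagWalk : ∀ {a b q r r′} → Walk (Graph.Adj G) a b q → a ∈ χ r → b ∈ χ r′ →
                 ∃ λ w → Walk (Graph.Adj T) r r′ w × All (Meets q) w
  walk⇒bagWalk (single a) a∈ b∈ with C3 a _ _ a∈ b∈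
  ... | w , (ww , _) , a∈χw = w , ww , All.map (λ a∈χr → a , here refl , a∈χr) a∈χw
  walk⇒bagWalk {a} (step e wk) a∈ b∈ with edge⇒bagWalk e
  ... | t , t′ , a∈χt , a′∈χt′ , w₂ , ww₂ , meets₂ with walk⇒bagWalk wk a′∈χt′ b∈
  ... | w₃ , ww₃ , meets₃ with C3 a _ t a∈ a∈χt
  ... | w₁ , (ww₁ , _) , a∈χw₁
    with append-All ww₂ ww₃
           (All.map [ (λ a∈χr → a , here refl , a∈χr) , (λ a′∈χr → _ , there (head∈ wk) , a′∈χr) ]′ meets₂)
           (All.map (Meets-mono there) meets₃)
  ... | w₂₃ , ww₂₃ , meets₂₃ =
    append-All ww₁ ww₂₃ (All.map (λ a∈χr → a , here refl , a∈χr) a∈χw₁) meets₂₃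

  treePath-bags-meet-walk : ∀ {a b q r r′ p} → IsPath (Graph.Adj T) r r′ p →
                            Walk (Graph.Adj G) a b q → a ∈ χ r → b ∈ χ r′ → All (Meets q) p
  treePath-bags-meet-walk path wk a∈ b∈ with walk⇒bagWalk wk a∈ b∈
  ... | w , ww , meets = anti-mono (path⊆walk tree path ww) meets

xyPath⇒walkFromY : ∀ {n} {G : Graph n} {X Y D a b P x} → IsXYPathAvoiding G X Y D a b P →
                   a ≡ x ⊎ b ≡ x → ∃ λ c → c ∈ Y × ∃ λ q → Walk (Graph.Adj G) c x q × q ⊆ P
xyPath⇒walkFromY {G = G} ((w , _) , _ , inj₁ (_ , b∈Y)) x-end =
  _ , b∈Y , walkBetweenEnds (Graph.sym G) w (inj₂ refl) x-end
xyPath⇒walkFromY {G = G} ((w , _) , _ , inj₂ (a∈Y , _)) x-end =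
  _ , a∈Y , walkBetweenEnds (Graph.sym G) w (inj₁ refl) x-end

∈-tabulate⁻ : ∀ {n} {f : Fin n → Bool} {x} → x ∈ tabulate f → T (f x)
∈-tabulate⁻ {f = f} {x} x∈ = Equivalence.from T-≡ (trans (sym (lookup∘tabulate f x)) ([]=⇒lookup x∈))

∈ᵇ⇒∈ : ∀ {m} {t : Fin m} (p : List (Fin m)) → T (t ∈ᵇ p) → t ∈ₗ p
∈ᵇ⇒∈ p = Any.map (sym ∘ toWitness) ∘ any⁻ _ p

∈χ'⁻ : ∀ {n m} (χ : Fin m → Subset n) (S C' : Subset n) (Z : Fin n → List (Fin m)) {t x} →
       x ∈ χ' χ S C' Z t → (x ∈ χ t × x ∈ C') ⊎ (x ∈ S × t ∈ₗ Z x)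
∈χ'⁻ χ S C' Z {t} {x} x∈ with x∈p∪q⁻ (χ t ∩ C') _ x∈
... | inj₁ x∈χt∩C' = inj₁ (x∈p∩q⁻ (χ t) C' x∈χt∩C')
... | inj₂ x∈Zs with Equivalence.to T-∧ (∈-tabulate⁻ x∈Zs)
... | x∈S , t∈Zx = inj₂ (toWitness x∈S , ∈ᵇ⇒∈ (Z x) t∈Zx)

∣p∣≤∣q∣-byMatching : ∀ {n k} {p : Subset n} {q : Subset k} (R : Fin n → Fin k → Set) →
                     (∀ {x} → x ∈ p → ∃ λ y → y ∈ q × R x y) →
                     (∀ {x x′ y} → R x y → R x′ y → x ≡ x′) → ∣ p ∣ ≤ ∣ q ∣
∣p∣≤∣q∣-byMatching {p = []} R match inj = z≤n
∣p∣≤∣q∣-byMatching {p = outside ∷ p} R match inj =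
  ∣p∣≤∣q∣-byMatching {p = p} (R ∘ suc) (match ∘ there) (λ Rxy Rx′y → suc-injective (inj Rxy Rx′y))
∣p∣≤∣q∣-byMatching {p = inside ∷ p} {q} R match inj with match here
... | y , y∈q , R0y = ≤-trans (s≤s (∣p∣≤∣q∣-byMatching {p = p} {q - y} (R ∘ suc) match′
                                       (λ Rxy Rx′y → suc-injective (inj Rxy Rx′y))))
                              (x∈p⇒∣p-x∣<∣p∣ y∈q)
  where
  match′ : ∀ {x} → x ∈ p → ∃ λ y′ → y′ ∈ q - y × R (suc x) y′
  match′ x∈p with match (there x∈p)
  ... | y′ , y′∈q , Rxy′ = y′ , x∈p∧x≢y⇒x∈p-y y′∈q (λ { refl → 0≢1+n (inj R0y Rxy′) }) , Rxy′

mainTheorem20 : ∀ {n m : ℕ} (G : Graph n) (S C' : Subset n) → IsComponentOfMinus G S C' →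
    (T : Graph m) (χ : Fin m → Subset n) → IsLenientTD G T χ →
    (s : Fin m) (Z : Fin n → List (Fin m)) →
    (∀ x → x ∈ S → ∃ λ t → x ∈ χ t × IsPath (Graph.Adj T) s t (Z x)) →
    (P : Fin n → List (Fin n)) →
    (∀ x → x ∈ S → ∃ λ a → ∃ λ b →
    IsXYPathAvoiding G S (χ s) C' a b (P x) × (a ≡ x ⊎ b ≡ x)) →
    (∀ x y → x ∈ S → y ∈ S → ¬ x ≡ y → ∀ v → v ∈ₗ P x → ¬ v ∈ₗ P y) →
    ∀ t → ∣ χ' χ S C' Z t ∣ ≤ ∣ χ t ∣
mainTheorem20 {n} G S C' _ T χ td s Z Z-path P P-path P-disjoint t =
  ∣p∣≤∣q∣-byMatching ChargedTo charge charge-injective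
  where
  ChargedTo : Fin n → Fin n → Set
  ChargedTo x y = (x ∈ C' × y ≡ x) ⊎ (x ∈ S × y ∈ₗ P x × y ∉ C')

  charge : ∀ {x} → x ∈ χ' χ S C' Z t → ∃ λ y → y ∈ χ t × ChargedTo x y
  charge {x} x∈ with ∈χ'⁻ χ S C' Z x∈
  ... | inj₁ (x∈χt , x∈C') = x , x∈χt , inj₁ (x∈C' , refl)
  ... | inj₂ (x∈S , t∈Zx) with P-path x x∈S | Z-path x x∈S
  ... | _ , _ , xyPath@(_ , avoidsC' , _) , x-end | _ , x∈χtₓ , Zx-path
    with xyPath⇒walkFromY {G = G} {S} {χ s} {C'} xyPath x-end
  ... | c , c∈χs , q , wq , q⊆Px
    with All.lookup (treePath-bags-meet-walk td Zx-path wq c∈χs x∈χtₓ) t∈Zx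
  ... | v , v∈q , v∈χt = v , v∈χt , inj₂ (x∈S , q⊆Px v∈q , All.lookup avoidsC' (q⊆Px v∈q))

  charge-injective : ∀ {x x′ y} → ChargedTo x y → ChargedTo x′ y → x ≡ x′
  charge-injective (inj₁ (_ , refl)) (inj₁ (_ , refl)) = refl
  charge-injective (inj₁ (x∈C' , refl)) (inj₂ (_ , _ , y∉C')) = ⊥-elim (y∉C' x∈C')
  charge-injective (inj₂ (_ , _ , y∉C')) (inj₁ (x∈C' , refl)) = ⊥-elim (y∉C' x∈C')
  charge-injective {x} {x′} (inj₂ (x∈S , y∈Px , _)) (inj₂ (x′∈S , y∈Px′ , _)) with x ≟ x′
  ... | yes x≡x′ = x≡x′
  ... | no x≢x′ = ⊥-elim (P-disjoint x x′ x∈S x′∈S x≢x′ _ y∈Px y∈Px′)
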